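{- The following two statements are equivalent: (a) (Oriented Alon–Saks–Seymour conjecture) there exists a polynomial $P$ such that every graph $G$ satisfies $\chi(G)\le P(\mathbf{bp}_{or}(G))$; (b) (Clique–Stable Set separation conjecture) there exists a polynomial $Q$ such that every graph on $n$ vertices has a CS-separator of size at most $Q(n)$.
   Context: $\chi(G)$ is the chromatic number. The oriented bipartite packing $\mathbf{bp}_{or}(G)$ of an undirected graph $G$ is the minimum $k$ such that there exist pairs $(A_1,B_1),\dots,(A_k,B_k)$ of disjoint vertex subsets with every vertex of $A_i$ adjacent to every vertex of $B_i$, such that every edge $xy$ satisfies $x\in A_i,y\in B_i$ or $y\in A_i,x\in B_i$ for some $i$, and there is no ordered pair $(x,y)$ and distinct $i\neq j$ with $x\in A_i\cap A_j$ and $y\in B_i\cap B_j$. A cut of $G=(V,E)$ is a pair $(A,B)$ with $A\cup B=V$, $A\cap B=\emptyset$; it separates a clique $K$ and a stable set $S$ if $K\subseteq A$, $S\subseteq B$. A CS-separator is a family of cuts separating every clique $K$ from every stable set $S$ with $K\cap S=\emptyset$. -}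

module Defs where

open import Data.Nat using (ℕ; zero; suc; _+_; _*_; _≤_; _<_)
open import Data.List using (List; foldr)
open import Data.Bool using (Bool; true)
open import Data.Fin using (Fin)
open import Data.Fin.Subset using (Subset; _∈_; _∉_)
open import Data.Product using (Σ; ∃; _×_; _,_)
open import Data.Sum using (_⊎_)
open import Data.Empty using (⊥)
open import Relation.Nullary using (¬_)
open import Relation.Binary.PropositionalEquality using (_≡_; _≢_)

-- Polynomials with natural-number coefficients (constant term first).
Poly : Set
Poly = List ℕ

eval : Poly → ℕ → ℕ
eval p x = foldr (λ a acc → a + x * acc) 0 p

record Graph (n : ℕ) : Set where
  field
    adj   : Fin n → Fin n → Bool
    sym   : ∀ x y → adj x y ≡ adj y x
    irrfl : ∀ x → adj x x ≡ true → ⊥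

open Graph public

Edge : ∀ {n} → Graph n → Fin n → Fin n → Set
Edge G x y = adj G x y ≡ true

-- Proper colouring with k colours; χ(G) ≤ k iff Colorable G k.
Colorable : ∀ {n} → Graph n → ℕ → Set
Colorable {n} G k =
  Σ (Fin n → Fin k) λ c → ∀ x y → Edge G x y → c x ≢ c y

OrientedBP : ∀ {n} → Graph n → ℕ → Set
OrientedBP {n} G k =
  Σ (Fin k → Subset n) λ A → Σ (Fin k → Subset n) λ B →
    (∀ i x → x ∈ A i → x ∉ B i)
  × (∀ i x y → x ∈ A i → y ∈ B i → Edge G x y)
  × (∀ x y → Edge G x y → ∃ λ i → (x ∈ A i × y ∈ B i) ⊎ (y ∈ A i × x ∈ B i))
  × (∀ i j x y → i ≢ j → x ∈ A i → x ∈ A j → y ∈ B i → y ∈ B j → ⊥)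

IsBPor : ∀ {n} → Graph n → ℕ → Set
IsBPor G k = OrientedBP G k × (∀ j → j < k → ¬ OrientedBP G j)

IsClique : ∀ {n} → Graph n → Subset n → Set
IsClique G K = ∀ x y → x ∈ K → y ∈ K → x ≢ y → Edge G x y

IsStable : ∀ {n} → Graph n → Subset n → Set
IsStable G S = ∀ x y → x ∈ S → y ∈ S → ¬ Edge G x y

-- A cut (A, V∖A) is represented by its side A.
Separates : ∀ {n} → Subset n → Subset n → Subset n → Set
Separates A K S = (∀ x → x ∈ K → x ∈ A) × (∀ x → x ∈ S → x ∉ A)

Disjoint : ∀ {n} → Subset n → Subset n → Set
Disjoint K S = ∀ x → x ∈ K → x ∈ S → ⊥

CSSeparator : ∀ {n} → Graph n → (m : ℕ) → (Fin m → Subset n) → Set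
CSSeparator {n} G m cuts =
  ∀ (K S : Subset n) → IsClique G K → IsStable G S → Disjoint K S →
    ∃ λ i → Separates (cuts i) K S

HasCSSepOfSize≤ : ∀ {n} → Graph n → ℕ → Set
HasCSSepOfSize≤ {n} G m =
  Σ ℕ λ m' → m' ≤ m × Σ (Fin m' → Subset n) λ cuts → CSSeparator G m' cuts

-- (b) ⇒ (a): given an oriented bipartite packing (Aᵢ, Bᵢ)ᵢ<k of G, let H be the
-- intersection graph of the Bᵢ on k vertices. Each vertex x of G yields the clique
-- {i : x ∈ Bᵢ} and the stable set {i : x ∈ Aᵢ} of H (stable because no pair (x, y)
-- is covered twice, disjoint because Aᵢ ∩ Bᵢ = ∅). Colouring x by a cut of a
-- CS-separator of H separating these two sets is proper: an edge xy lies in some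
-- Aᵢ × Bᵢ, and i is on different sides of the cuts chosen for x and for y.
--
-- (a) ⇒ (b): let H be the graph whose vertices are the pairs (K, S) of a clique and
-- a disjoint stable set of G, with (K, S) ~ (K', S') when K meets S' or K' meets S.
-- The n bicliques ({(K, S) : x ∈ K}, {(K, S) : x ∈ S}), x ∈ V(G), form an oriented
-- bipartite packing of H, so χ(H) ≤ P(n); and for each colour c, the union of the
-- cliques K coloured c is a cut separating every pair coloured c.
module Submission where

open import Defs hiding (sym)
open import Level using (Level)
open import Data.Nat using (ℕ; _^_; _*_; _≤_; _<_; z≤n)
open import Data.Nat.Properties using (≤-refl; ≤-trans; <⇒≤; +-monoʳ-≤; *-mono-≤)
open import Data.Nat.Induction using (<-rec)
open import Data.Bool using (true)
import Data.Bool.Properties as Bool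
open import Data.List using ([]; _∷_)
open import Data.Vec using (lookup; tabulate)
open import Data.Vec.Properties using (lookup∘tabulate; tabulate∘lookup; tabulate-cong; lookup⇒[]=; []=⇒lookup)
open import Data.Fin using (Fin; inject≤; combine; remQuot; funToFin; finToFun; _≟_)
open import Data.Fin.Properties using (any?; all?; inject≤-injective; remQuot-combine; finToFun-funToFin; 2↔Bool)
open import Data.Fin.Subset using (Subset; _∈_; _∉_)
open import Data.Fin.Subset.Properties using (_∈?_)
open import Data.Product using (∃; _×_; _,_; proj₁; proj₂)
import Data.Product as Product
open import Data.Sum using (_⊎_; inj₁; inj₂)
import Data.Sum as Sum
open import Data.Empty using (⊥)
open import Function using (_∘_)
open import Function.Bundles using (_⇔_; mk⇔; Inverse)
open import Relation.Unary using (Pred; Decidable)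
open import Relation.Nullary using (¬_; Dec; yes; no; does)
open import Relation.Nullary.Decidable using (dec-true; does-⇔; decidable-stable; map′; _×-dec_; _⊎-dec_; _→-dec_; ¬?)
open import Relation.Nullary.Negation using (¬¬-map)
open import Relation.Binary.PropositionalEquality using (_≡_; _≢_; refl; sym; trans; cong; cong₂; subst; subst₂; module ≡-Reasoning)

private
  variable
    ℓ : Level
    n k m : ℕ

does-true⇒ : ∀ {A : Set ℓ} (a? : Dec A) → does a? ≡ true → A
does-true⇒ (yes a) _ = a

subset : {P : Pred (Fin n) ℓ} → Decidable P → Subset n
subset P? = tabulate (does ∘ P?)

module _ {P : Pred (Fin n) ℓ} (P? : Decidable P) where

  ∈-subset⁺ : ∀ {x} → P x → x ∈ subset P?
  ∈-subset⁺ {x} p = lookup⇒[]= x _ (trans (lookup∘tabulate _ x) (dec-true (P? x) p))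

  ∈-subset⁻ : ∀ {x} → x ∈ subset P? → P x
  ∈-subset⁻ {x} x∈ = does-true⇒ (P? x) (trans (sym (lookup∘tabulate _ x)) ([]=⇒lookup x∈))

module RelationGraph {R : Fin n → Fin n → Set ℓ} (R? : ∀ x y → Dec (R x y))
                     (R-sym : ∀ {x y} → R x y → R y x) (R-irrefl : ∀ {x} → ¬ R x x) where

  graph : Graph n
  graph = record
    { adj   = λ x y → does (R? x y)
    ; sym   = λ x y → does-⇔ (mk⇔ R-sym R-sym) (R? x y) (R? y x)
    ; irrfl = λ x e → R-irrefl (does-true⇒ (R? x x) e)
    }

  edge⁺ : ∀ {x y} → R x y → Edge graph x y
  edge⁺ {x} {y} = dec-true (R? x y)

  edge⁻ : ∀ {x y} → Edge graph x y → R x y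
  edge⁻ {x} {y} = does-true⇒ (R? x y)

edge? : (G : Graph n) → ∀ x y → Dec (Edge G x y)
edge? G x y = adj G x y Bool.≟ true

clique? : (G : Graph n) → ∀ K → Dec (IsClique G K)
clique? G K = all? λ x → all? λ y → x ∈? K →-dec y ∈? K →-dec ¬? (x ≟ y) →-dec edge? G x y

stable? : (G : Graph n) → ∀ S → Dec (IsStable G S)
stable? G S = all? λ x → all? λ y → x ∈? S →-dec y ∈? S →-dec ¬? (edge? G x y)

disjoint? : (K S : Subset n) → Dec (Disjoint K S)
disjoint? K S = all? λ x → x ∈? K →-dec x ∈? S →-dec no λ ()

Meets : Subset n → Subset n → Set
Meets K S = ∃ λ x → x ∈ K × x ∈ S

meets? : (K S : Subset n) → Dec (Meets K S)
meets? K S = any? λ x → x ∈? K ×-dec x ∈? S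

Proper : (G : Graph n) → (Fin n → Fin k) → Set
Proper G c = ∀ x y → Edge G x y → c x ≢ c y

proper? : (G : Graph n) (c : Fin n → Fin k) → Dec (Proper G c)
proper? G c = all? λ x → all? λ y → edge? G x y →-dec ¬? (c x ≟ c y)

colorable-mono : (G : Graph n) {a b : ℕ} → Colorable G a → a ≤ b → Colorable G b
colorable-mono G (c , proper) a≤b =
  (λ x → inject≤ (c x) a≤b) , λ x y e eq → proper x y e (inject≤-injective a≤b a≤b _ _ eq)

colorable? : (G : Graph n) → ∀ k → Dec (Colorable G k)
colorable? G k = map′ (λ (i , proper) → finToFun i , proper) encode (any? λ i → proper? G (finToFun i))
  where
  encode : Colorable G k → ∃ λ i → Proper G (finToFun i)
  encode (c , proper) = funToFin c , λ x y e →
    subst₂ _≢_ (sym (finToFun-funToFin c x)) (sym (finToFun-funToFin c y)) (proper x y e)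

eval-mono : ∀ p {a b} → a ≤ b → eval p a ≤ eval p b
eval-mono []      _   = z≤n
eval-mono (c ∷ p) a≤b = +-monoʳ-≤ c (*-mono-≤ a≤b (eval-mono p a≤b))

least-below : {P : Pred ℕ ℓ} → ∀ j → P j → ¬ ¬ ∃ λ k → k ≤ j × P k × (∀ i → i < k → ¬ P i)
least-below = <-rec _ λ j rec pj noLeast →
  noLeast (j , ≤-refl , pj , λ i i<j pi →
    rec i<j pi λ (k , k≤i , least) → noLeast (k , ≤-trans k≤i (<⇒≤ i<j) , least))

-- Constructively a packing only has a minimum up to double negation; this is
-- harmless because colourability is decidable.
bp-bound⇒colorable : (G : Graph n) (P : Poly) → (∀ k → IsBPor G k → Colorable G (eval P k)) →
                     OrientedBP G k → Colorable G (eval P k)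
bp-bound⇒colorable {k = j} G P bound bp = decidable-stable (colorable? G _)
  (¬¬-map (λ (k , k≤j , isBP) → colorable-mono G (bound k isBP) (eval-mono P k≤j))
          (least-below j bp))

module IntersectionGraph {k n : ℕ} (B : Fin k → Subset n) =
  RelationGraph (λ i j → ¬? (i ≟ j) ×-dec meets? (B i) (B j))
                (λ (i≢j , x , x∈Bi , x∈Bj) → i≢j ∘ sym , x , x∈Bj , x∈Bi) (λ (i≢i , _) → i≢i refl)

intersectionGraph : (Fin k → Subset n) → Graph k
intersectionGraph = IntersectionGraph.graph

module _ (G : Graph n) (A B : Fin k → Subset n)
         (A∩B≡∅ : ∀ i x → x ∈ A i → x ∉ B i)
         (covered : ∀ x y → Edge G x y → ∃ λ i → (x ∈ A i × y ∈ B i) ⊎ (y ∈ A i × x ∈ B i))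
         (once : ∀ i j x y → i ≢ j → x ∈ A i → x ∈ A j → y ∈ B i → y ∈ B j → ⊥) where

  private
    H : Graph k
    H = intersectionGraph B
    open IntersectionGraph B using (edge⁺; edge⁻)

    inA? inB? : ∀ x i → Dec (x ∈ _)
    inA? x i = x ∈? A i
    inB? x i = x ∈? B i

  A-indices B-indices : Fin n → Subset k
  A-indices x = subset (inA? x)
  B-indices x = subset (inB? x)

  B-indices-clique : ∀ x → IsClique H (B-indices x)
  B-indices-clique x i j i∈ j∈ i≢j = edge⁺ (i≢j , x , ∈-subset⁻ (inB? x) i∈ , ∈-subset⁻ (inB? x) j∈)

  A-indices-stable : ∀ x → IsStable H (A-indices x)
  A-indices-stable x i j i∈ j∈ e with edge⁻ e
  ... | i≢j , y , y∈Bi , y∈Bj =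
    once i j x y i≢j (∈-subset⁻ (inA? x) i∈) (∈-subset⁻ (inA? x) j∈) y∈Bi y∈Bj

  indices-disjoint : ∀ x → Disjoint (B-indices x) (A-indices x)
  indices-disjoint x i i∈B i∈A = A∩B≡∅ i x (∈-subset⁻ (inA? x) i∈A) (∈-subset⁻ (inB? x) i∈B)

  colorable-from-separator : ∀ {m} (cuts : Fin m → Subset k) → CSSeparator H m cuts → Colorable G m
  colorable-from-separator {m} cuts separator = colour , proper
    where
    separating : ∀ x → ∃ λ c → Separates (cuts c) (B-indices x) (A-indices x)
    separating x = separator _ _ (B-indices-clique x) (A-indices-stable x) (indices-disjoint x)

    colour : Fin n → Fin m
    colour = proj₁ ∘ separating

    apart : ∀ {i x y} → x ∈ A i → y ∈ B i → colour x ≢ colour y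
    apart {i} {x} {y} x∈Ai y∈Bi eq =
      proj₂ (proj₂ (separating x)) i (∈-subset⁺ (inA? x) x∈Ai)
        (subst (λ c → i ∈ cuts c) (sym eq) (proj₁ (proj₂ (separating y)) i (∈-subset⁺ (inB? y) y∈Bi)))

    proper : Proper G colour
    proper x y e with covered x y e
    ... | _ , inj₁ (x∈A , y∈B) = apart x∈A y∈B
    ... | _ , inj₂ (y∈A , x∈B) = apart y∈A x∈B ∘ sym

CSPair : Graph n → Subset n × Subset n → Set
CSPair G (K , S) = IsClique G K × IsStable G S × Disjoint K S

csPair? : (G : Graph n) → ∀ p → Dec (CSPair G p)
csPair? G (K , S) = clique? G K ×-dec stable? G S ×-dec disjoint? K S

Conflict : Graph n → Subset n × Subset n → Subset n × Subset n → Set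
Conflict G p@(K , S) q@(K' , S') = CSPair G p × CSPair G q × (Meets K S' ⊎ Meets K' S)

-- Vertices are codes of pairs of subsets; codes of pairs that are not CS-pairs
-- become isolated vertices.
module ConflictGraph {N : ℕ} (G : Graph n) (decode : Fin N → Subset n × Subset n)
                     (encode : Subset n × Subset n → Fin N)
                     (decode-encode : ∀ p → decode (encode p) ≡ p) where

  private
    R : Fin N → Fin N → Set
    R v w = Conflict G (decode v) (decode w)

    R? : ∀ v w → Dec (R v w)
    R? v w = let (K , S) = decode v ; (K' , S') = decode w in
      csPair? G (decode v) ×-dec csPair? G (decode w) ×-dec (meets? K S' ⊎-dec meets? K' S)

    R-irrefl : ∀ {v} → ¬ R v v
    R-irrefl (cs , _ , inj₁ (x , x∈K , x∈S)) = proj₂ (proj₂ cs) x x∈K x∈S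
    R-irrefl (cs , _ , inj₂ (x , x∈K , x∈S)) = proj₂ (proj₂ cs) x x∈K x∈S

    open RelationGraph R? (λ (p , q , m) → q , p , Sum.swap m) R-irrefl

  conflictGraph : Graph N
  conflictGraph = graph

  private
    inClique? : ∀ x v → Dec (CSPair G (decode v) × x ∈ proj₁ (decode v))
    inClique? x v = csPair? G (decode v) ×-dec x ∈? proj₁ (decode v)

    inStable? : ∀ x v → Dec (CSPair G (decode v) × x ∈ proj₂ (decode v))
    inStable? x v = csPair? G (decode v) ×-dec x ∈? proj₂ (decode v)

  clique-side stable-side : Fin n → Subset N
  clique-side x = subset (inClique? x)
  stable-side x = subset (inStable? x)

  conflictGraph-packing : OrientedBP conflictGraph n
  conflictGraph-packing = clique-side , stable-side , disjoint , complete , covered , once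
    where
    disjoint : ∀ x v → v ∈ clique-side x → v ∉ stable-side x
    disjoint x v v∈K v∈S with ∈-subset⁻ (inClique? x) v∈K | ∈-subset⁻ (inStable? x) v∈S
    ... | (_ , _ , K∩S≡∅) , x∈K | _ , x∈S = K∩S≡∅ x x∈K x∈S

    complete : ∀ x v w → v ∈ clique-side x → w ∈ stable-side x → Edge conflictGraph v w
    complete x v w v∈K w∈S with ∈-subset⁻ (inClique? x) v∈K | ∈-subset⁻ (inStable? x) w∈S
    ... | csv , x∈K | csw , x∈S = edge⁺ (csv , csw , inj₁ (x , x∈K , x∈S))

    covered : ∀ v w → Edge conflictGraph v w →
              ∃ λ x → (v ∈ clique-side x × w ∈ stable-side x) ⊎ (w ∈ clique-side x × v ∈ stable-side x)
    covered v w e with edge⁻ e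
    ... | csv , csw , inj₁ (x , x∈K , x∈S) =
      x , inj₁ (∈-subset⁺ (inClique? x) (csv , x∈K) , ∈-subset⁺ (inStable? x) (csw , x∈S))
    ... | csv , csw , inj₂ (x , x∈K , x∈S) =
      x , inj₂ (∈-subset⁺ (inClique? x) (csw , x∈K) , ∈-subset⁺ (inStable? x) (csv , x∈S))

    once : ∀ x y v w → x ≢ y → v ∈ clique-side x → v ∈ clique-side y →
           w ∈ stable-side x → w ∈ stable-side y → ⊥
    once x y v w x≢y vx vy wx wy
      with ∈-subset⁻ (inClique? x) vx | ∈-subset⁻ (inClique? y) vy
         | ∈-subset⁻ (inStable? x) wx | ∈-subset⁻ (inStable? y) wy
    ... | (clique , _) , x∈K | _ , y∈K | (_ , stable , _) , x∈S | _ , y∈S =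
      stable x y x∈S y∈S (clique x y x∈K y∈K x≢y)

  module _ (colour : Fin N → Fin m) (proper : Proper conflictGraph colour) where

    colourClass? : ∀ c x → Dec (∃ λ v → CSPair G (decode v) × colour v ≡ c × x ∈ proj₁ (decode v))
    colourClass? c x = any? λ v → csPair? G (decode v) ×-dec colour v ≟ c ×-dec x ∈? proj₁ (decode v)

    colourCuts : Fin m → Subset n
    colourCuts c = subset (colourClass? c)

    colourCuts-separator : CSSeparator G m colourCuts
    colourCuts-separator K S clique stable K∩S≡∅ = colour v , K⊆cut , S∩cut≡∅
      where
      v : Fin N
      v = encode (K , S)

      KS≡v : (K , S) ≡ decode v
      KS≡v = sym (decode-encode (K , S))

      cs : CSPair G (decode v)
      cs = subst (CSPair G) KS≡v (clique , stable , K∩S≡∅)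

      K⊆cut : ∀ x → x ∈ K → x ∈ colourCuts (colour v)
      K⊆cut x x∈K = ∈-subset⁺ (colourClass? (colour v)) (v , cs , refl , subst ((x ∈_) ∘ proj₁) KS≡v x∈K)

      S∩cut≡∅ : ∀ x → x ∈ S → x ∉ colourCuts (colour v)
      S∩cut≡∅ x x∈S x∈cut with ∈-subset⁻ (colourClass? (colour v)) x∈cut
      ... | w , csw , same , x∈K' =
        proper w v (edge⁺ (csw , cs , inj₁ (x , x∈K' , subst ((x ∈_) ∘ proj₂) KS≡v x∈S))) same

decodeSubset : Fin (2 ^ n) → Subset n
decodeSubset i = tabulate (Inverse.to 2↔Bool ∘ finToFun i)

encodeSubset : Subset n → Fin (2 ^ n)
encodeSubset p = funToFin (Inverse.from 2↔Bool ∘ lookup p)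

decodeSubset-encodeSubset : ∀ (p : Subset n) → decodeSubset (encodeSubset p) ≡ p
decodeSubset-encodeSubset p = trans (tabulate-cong pointwise) (tabulate∘lookup p)
  where
  pointwise : ∀ x → Inverse.to 2↔Bool (finToFun (encodeSubset p) x) ≡ lookup p x
  pointwise x = trans (cong (Inverse.to 2↔Bool) (finToFun-funToFin _ x))
                      (Inverse.strictlyInverseˡ 2↔Bool (lookup p x))

decodePair : Fin (2 ^ n * 2 ^ n) → Subset n × Subset n
decodePair = Product.map decodeSubset decodeSubset ∘ remQuot _

encodePair : Subset n × Subset n → Fin (2 ^ n * 2 ^ n)
encodePair (K , S) = combine (encodeSubset K) (encodeSubset S)

decodePair-encodePair : ∀ (p : Subset n × Subset n) → decodePair (encodePair p) ≡ p
decodePair-encodePair (K , S) = begin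
  Product.map decodeSubset decodeSubset (remQuot _ (combine (encodeSubset K) (encodeSubset S)))
    ≡⟨ cong (Product.map decodeSubset decodeSubset) (remQuot-combine (encodeSubset K) (encodeSubset S)) ⟩
  decodeSubset (encodeSubset K) , decodeSubset (encodeSubset S)
    ≡⟨ cong₂ _,_ (decodeSubset-encodeSubset K) (decodeSubset-encodeSubset S) ⟩
  K , S ∎
  where open ≡-Reasoning

OrientedAlonSaksSeymour CliqueStableSeparation : Set
OrientedAlonSaksSeymour = ∃ λ (P : Poly) → ∀ n (G : Graph n) k → IsBPor G k → Colorable G (eval P k)
CliqueStableSeparation  = ∃ λ (Q : Poly) → ∀ n (G : Graph n) → HasCSSepOfSize≤ G (eval Q n)

orientedAlonSaksSeymour⇒cliqueStableSeparation : OrientedAlonSaksSeymour → CliqueStableSeparation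
orientedAlonSaksSeymour⇒cliqueStableSeparation (P , bound) = P , λ n G →
  let open ConflictGraph G decodePair encodePair decodePair-encodePair
      (colour , proper) = bp-bound⇒colorable conflictGraph P (bound _ conflictGraph) conflictGraph-packing
  in eval P n , ≤-refl , colourCuts colour proper , colourCuts-separator colour proper

cliqueStableSeparation⇒orientedAlonSaksSeymour : CliqueStableSeparation → OrientedAlonSaksSeymour
cliqueStableSeparation⇒orientedAlonSaksSeymour (Q , separated) =
  Q , λ n G k ((A , B , A∩B≡∅ , _ , covered , once) , _) →
  let (m , m≤ , cuts , separator) = separated k (intersectionGraph B)
  in colorable-mono G (colorable-from-separator G A B A∩B≡∅ covered once cuts separator) m≤

theorem18 : (∃ λ (P : Poly) → ∀ (n : ℕ) (G : Graph n) (k : ℕ) → IsBPor G k → Colorable G (eval P k))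
    ⇔ (∃ λ (Q : Poly) → ∀ (n : ℕ) (G : Graph n) → HasCSSepOfSize≤ G (eval Q n))
theorem18 = mk⇔ orientedAlonSaksSeymour⇒cliqueStableSeparation cliqueStableSeparation⇒orientedAlonSaksSeymour
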